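{- (Bounded substitution theorem for $\mathcal{G}^c$.) For every pattern $\varphi$ and element variables $x,y$ such that $y$ does not occur in $\varphi$, $\vdash_{\mathcal{G}^c}\varphi\leftrightarrow\mathrm{Subb}_x^y\varphi$.
   Context: Fix a countably infinite set $EVar$ of element variables and a set $\Sigma$ of constant symbols. Patterns: $\varphi::= x\mid \sigma\mid \bot\mid \neg\varphi\mid \varphi\to\varphi\mid \varphi\wedge\varphi\mid\varphi\vee\varphi\mid \varphi\cdot\varphi\mid \forall x\varphi\mid\exists x\varphi$ ($\varphi\cdot\psi$ is application); $\varphi\leftrightarrow\psi:=(\varphi\to\psi)\wedge(\psi\to\varphi)$. An occurrence of $x$ is bound if inside a subpattern $\forall x\eta$ or $\exists x\eta$, otherwise free; $FV(\varphi)$ is the set of variables with a free occurrence. $\mathrm{Subf}_x^y\varphi$ replaces every free occurrence of $x$ in $\varphi$ by $y$; "$x$ is free for $y$ in $\varphi$" means no free occurrence of $x$ in $\varphi$ lies inside a subpattern of the form $\forall y\eta$ or $\exists y\eta$. Bounded substitution $\mathrm{Subb}_x^y\varphi$ is defined recursively: it is $\varphi$ for atomic $\varphi$; it commutes with $\neg,\to,\wedge,\vee$ and application; $\mathrm{Subb}_x^y(Qz\eta)=Qz\,\mathrm{Subb}_x^y\eta$ for $z\neq x$, and $\mathrm{Subb}_x^y(Qx\eta)=Qy\,\mathrm{Subf}_x^y(\mathrm{Subb}_x^y\eta)$, for $Q\in\{\forall,\exists\}$. $\vdash\psi$ means there is a finite sequence ending in $\psi$ of axiom instances or consequences of earlier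 members by rules. System $\mathcal{G}^c$. Axioms: $\varphi\vee\varphi\to\varphi$; $\varphi\to\varphi\wedge\varphi$; $\varphi\to\varphi\vee\psi$; $\varphi\wedge\psi\to\varphi$; $\varphi\vee\psi\to\psi\vee\varphi$; $\varphi\wedge\psi\to\psi\wedge\varphi$; $\bot\to\varphi$; $\varphi\vee\neg\varphi$; $\neg\varphi\to(\varphi\to\bot)$; $(\varphi\to\bot)\to\neg\varphi$; $\mathrm{Subf}_x^y\varphi\to\exists x\varphi$ and $\forall x\varphi\to\mathrm{Subf}_x^y\varphi$ whenever $x$ is free for $y$ in $\varphi$; $\varphi\cdot\bot\to\bot$; $\bot\cdot\varphi\to\bot$; $(\varphi\vee\psi)\cdot\chi\to\varphi\cdot\chi\vee\psi\cdot\chi$; $\chi\cdot(\varphi\vee\psi)\to\chi\cdot\varphi\vee\chi\cdot\psi$; $(\exists x\varphi)\cdot\psi\to\exists x(\varphi\cdot\psi)$ and $\psi\cdot(\exists x\varphi)\to\exists x(\psi\cdot\varphi)$ whenever $x$ does not occur in $\psi$. Rules: from $\varphi$, $\varphi\to\psi$ infer $\psi$; from $\varphi\to\psi$, $\psi\to\chi$ infer $\varphi\to\chi$; from $\varphi\wedge\psi\to\chi$ infer $\varphi\to(\psi\to\chi)$; from $\varphi\to(\psi\to\chi)$ infer $\varphi\wedge\psi\to\chi$; from $\varphi\to\psi$ infer $\chi\vee\varphi\to\chi\vee\psi$; from $\varphi\to\psi$ infer $\exists x\varphi\to\psi$ if $x\notin FV(\psi)$; from $\varphi\to\psi$ infer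 $\varphi\to\forall x\psi$ if $x\notin FV(\varphi)$; from $\varphi\to\psi$ infer $\varphi\cdot\chi\to\psi\cdot\chi$ and $\chi\cdot\varphi\to\chi\cdot\psi$. -}

module Defs where

open import Data.Nat using (ℕ; _≟_)
open import Data.Bool using (Bool; true; false; if_then_else_)
open import Relation.Nullary using (¬_; Dec; yes; no)
open import Relation.Nullary.Decidable using (⌊_⌋)
open import Relation.Binary.PropositionalEquality using (_≡_; _≢_)
open import Data.Empty using (⊥)
open import Data.Unit using (⊤)
open import Data.Sum using (_⊎_)
open import Data.Product using (_×_)

EVar : Set
EVar = ℕ

data Pattern (Sig : Set) : Set where
  var   : EVar → Pattern Sig
  con   : Sig → Pattern Sig
  bot   : Pattern Sig
  neg   : Pattern Sig → Pattern Sig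
  _⇒_   : Pattern Sig → Pattern Sig → Pattern Sig
  _∧_   : Pattern Sig → Pattern Sig → Pattern Sig
  _∨_   : Pattern Sig → Pattern Sig → Pattern Sig
  _·_   : Pattern Sig → Pattern Sig → Pattern Sig
  all   : EVar → Pattern Sig → Pattern Sig
  ex    : EVar → Pattern Sig → Pattern Sig

infixr 4 _⇒_
infixr 6 _∧_
infixr 5 _∨_
infixl 8 _·_

module _ {Sig : Set} where

  _⇔_ : Pattern Sig → Pattern Sig → Pattern Sig
  φ ⇔ ψ = (φ ⇒ ψ) ∧ (ψ ⇒ φ)

  Free : EVar → Pattern Sig → Set
  Free x (var z)   = x ≡ z
  Free x (con _)   = ⊥
  Free x bot       = ⊥
  Free x (neg φ)   = Free x φ
  Free x (φ ⇒ ψ)   = Free x φ ⊎ Free x ψ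
  Free x (φ ∧ ψ)   = Free x φ ⊎ Free x ψ
  Free x (φ ∨ ψ)   = Free x φ ⊎ Free x ψ
  Free x (φ · ψ)   = Free x φ ⊎ Free x ψ
  Free x (all z φ) = x ≢ z × Free x φ
  Free x (ex z φ)  = x ≢ z × Free x φ

  Occurs : EVar → Pattern Sig → Set
  Occurs x (var z)   = x ≡ z
  Occurs x (con _)   = ⊥
  Occurs x bot       = ⊥
  Occurs x (neg φ)   = Occurs x φ
  Occurs x (φ ⇒ ψ)   = Occurs x φ ⊎ Occurs x ψ
  Occurs x (φ ∧ ψ)   = Occurs x φ ⊎ Occurs x ψ
  Occurs x (φ ∨ ψ)   = Occurs x φ ⊎ Occurs x ψ
  Occurs x (φ · ψ)   = Occurs x φ ⊎ Occurs x ψ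
  Occurs x (all z φ) = x ≡ z ⊎ Occurs x φ
  Occurs x (ex z φ)  = x ≡ z ⊎ Occurs x φ

  -- "x is free for y in φ": no free occurrence of x in φ lies inside
  -- a subpattern ∀y η or ∃y η.  Under a binder for x itself no occurrence
  -- of x is free in φ, so nothing is required there.
  FreeFor : EVar → EVar → Pattern Sig → Set
  FreeFor x y (var z)   = ⊤
  FreeFor x y (con _)   = ⊤
  FreeFor x y bot       = ⊤
  FreeFor x y (neg φ)   = FreeFor x y φ
  FreeFor x y (φ ⇒ ψ)   = FreeFor x y φ × FreeFor x y ψ
  FreeFor x y (φ ∧ ψ)   = FreeFor x y φ × FreeFor x y ψ
  FreeFor x y (φ ∨ ψ)   = FreeFor x y φ × FreeFor x y ψ
  FreeFor x y (φ · ψ)   = FreeFor x y φ × FreeFor x y ψ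
  FreeFor x y (all z φ) = (z ≡ x → ⊤) × (z ≢ x → (z ≡ y → ¬ Free x φ) × FreeFor x y φ)
  FreeFor x y (ex z φ)  = (z ≡ x → ⊤) × (z ≢ x → (z ≡ y → ¬ Free x φ) × FreeFor x y φ)

  Subf : EVar → EVar → Pattern Sig → Pattern Sig
  Subf x y (var z)   = if ⌊ z ≟ x ⌋ then var y else var z
  Subf x y (con s)   = con s
  Subf x y bot       = bot
  Subf x y (neg φ)   = neg (Subf x y φ)
  Subf x y (φ ⇒ ψ)   = Subf x y φ ⇒ Subf x y ψ
  Subf x y (φ ∧ ψ)   = Subf x y φ ∧ Subf x y ψ
  Subf x y (φ ∨ ψ)   = Subf x y φ ∨ Subf x y ψ
  Subf x y (φ · ψ)   = Subf x y φ · Subf x y ψ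
  Subf x y (all z φ) = if ⌊ z ≟ x ⌋ then all z φ else all z (Subf x y φ)
  Subf x y (ex z φ)  = if ⌊ z ≟ x ⌋ then ex z φ else ex z (Subf x y φ)

  Subb : EVar → EVar → Pattern Sig → Pattern Sig
  Subb x y (var z)   = var z
  Subb x y (con s)   = con s
  Subb x y bot       = bot
  Subb x y (neg φ)   = neg (Subb x y φ)
  Subb x y (φ ⇒ ψ)   = Subb x y φ ⇒ Subb x y ψ
  Subb x y (φ ∧ ψ)   = Subb x y φ ∧ Subb x y ψ
  Subb x y (φ ∨ ψ)   = Subb x y φ ∨ Subb x y ψ
  Subb x y (φ · ψ)   = Subb x y φ · Subb x y ψ
  Subb x y (all z φ) = if ⌊ z ≟ x ⌋ then all y (Subf x y (Subb x y φ)) else all z (Subb x y φ)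
  Subb x y (ex z φ)  = if ⌊ z ≟ x ⌋ then ex y (Subf x y (Subb x y φ)) else ex z (Subb x y φ)

data ⊢_ {Sig : Set} : Pattern Sig → Set where
  ax-∨-idem  : ∀ {φ} → ⊢ (φ ∨ φ ⇒ φ)
  ax-∧-dup   : ∀ {φ} → ⊢ (φ ⇒ φ ∧ φ)
  ax-∨-intro : ∀ {φ ψ} → ⊢ (φ ⇒ φ ∨ ψ)
  ax-∧-elim  : ∀ {φ ψ} → ⊢ (φ ∧ ψ ⇒ φ)
  ax-∨-comm  : ∀ {φ ψ} → ⊢ (φ ∨ ψ ⇒ ψ ∨ φ)
  ax-∧-comm  : ∀ {φ ψ} → ⊢ (φ ∧ ψ ⇒ ψ ∧ φ)
  ax-bot     : ∀ {φ} → ⊢ (bot ⇒ φ)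
  ax-lem     : ∀ {φ} → ⊢ (φ ∨ neg φ)
  ax-neg₁    : ∀ {φ} → ⊢ (neg φ ⇒ (φ ⇒ bot))
  ax-neg₂    : ∀ {φ} → ⊢ ((φ ⇒ bot) ⇒ neg φ)
  ax-∃-intro : ∀ {φ x y} → FreeFor x y φ → ⊢ (Subf x y φ ⇒ ex x φ)
  ax-∀-elim  : ∀ {φ x y} → FreeFor x y φ → ⊢ (all x φ ⇒ Subf x y φ)
  ax-prop-botˡ : ∀ {φ} → ⊢ (φ · bot ⇒ bot)
  ax-prop-botʳ : ∀ {φ} → ⊢ (bot · φ ⇒ bot)
  ax-prop-∨ˡ : ∀ {φ ψ χ} → ⊢ ((φ ∨ ψ) · χ ⇒ φ · χ ∨ ψ · χ)
  ax-prop-∨ʳ : ∀ {φ ψ χ} → ⊢ (χ · (φ ∨ ψ) ⇒ χ · φ ∨ χ · ψ)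
  ax-prop-∃ˡ : ∀ {φ ψ x} → ¬ Occurs x ψ → ⊢ ((ex x φ) · ψ ⇒ ex x (φ · ψ))
  ax-prop-∃ʳ : ∀ {φ ψ x} → ¬ Occurs x ψ → ⊢ (ψ · (ex x φ) ⇒ ex x (ψ · φ))
  mp         : ∀ {φ ψ} → ⊢ φ → ⊢ (φ ⇒ ψ) → ⊢ ψ
  syll       : ∀ {φ ψ χ} → ⊢ (φ ⇒ ψ) → ⊢ (ψ ⇒ χ) → ⊢ (φ ⇒ χ)
  exportation : ∀ {φ ψ χ} → ⊢ (φ ∧ ψ ⇒ χ) → ⊢ (φ ⇒ (ψ ⇒ χ))
  importation : ∀ {φ ψ χ} → ⊢ (φ ⇒ (ψ ⇒ χ)) → ⊢ (φ ∧ ψ ⇒ χ)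
  expansion  : ∀ {φ ψ χ} → ⊢ (φ ⇒ ψ) → ⊢ (χ ∨ φ ⇒ χ ∨ ψ)
  ∃-gen      : ∀ {φ ψ x} → ¬ Free x ψ → ⊢ (φ ⇒ ψ) → ⊢ (ex x φ ⇒ ψ)
  ∀-gen      : ∀ {φ ψ x} → ¬ Free x φ → ⊢ (φ ⇒ ψ) → ⊢ (φ ⇒ all x ψ)
  framingˡ   : ∀ {φ ψ χ} → ⊢ (φ ⇒ ψ) → ⊢ (φ · χ ⇒ ψ · χ)
  framingʳ   : ∀ {φ ψ χ} → ⊢ (φ ⇒ ψ) → ⊢ (χ · φ ⇒ χ · ψ)

{-# OPTIONS --safe #-}
module Submission where

-- Every connective respects provable equivalence, so the only
-- real step is the renaming of a bound variable: if y is not free in η and x is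
-- free for y in η, then ∀x η and ∀y η[y/x] (η[y/x] = Subf x y η) instantiate
-- to each other, because η[y/x][x/y] = η; dually for ∃. Since y does not occur
-- in φ, the already renamed body Subb x y η meets both side conditions.

open import Defs
open import Data.Nat using (_≟_)
open import Data.Product using (_×_; _,_; proj₁; proj₂; uncurry)
open import Data.Sum using (inj₁; inj₂)
open import Data.Unit using (tt)
open import Data.Empty using (⊥-elim)
open import Function using (_∘_)
open import Relation.Nullary using (¬_; yes; no)
open import Relation.Binary.PropositionalEquality
  using (_≡_; _≢_; refl; sym; ≢-sym; cong; cong₂)

private
  variable
    Sig : Set
    x y : EVar
    A A′ B B′ C : Pattern Sig

⇒-refl : ⊢ (A ⇒ A)
⇒-refl = syll ax-∧-dup ax-∧-elim

⇒-const : ⊢ B → ⊢ (A ⇒ B)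
⇒-const b = mp b (exportation ax-∧-elim)

∧-monoˡ : ⊢ (A ⇒ B) → ⊢ (A ∧ C ⇒ B ∧ C)
∧-monoˡ p = importation (syll p (exportation ⇒-refl))

∧-monoʳ : ⊢ (A ⇒ B) → ⊢ (C ∧ A ⇒ C ∧ B)
∧-monoʳ p = syll ax-∧-comm (syll (∧-monoˡ p) ax-∧-comm)

∧-mono : ⊢ (A ⇒ A′) → ⊢ (B ⇒ B′) → ⊢ (A ∧ B ⇒ A′ ∧ B′)
∧-mono p q = syll (∧-monoˡ p) (∧-monoʳ q)

∧-intro : ⊢ A → ⊢ B → ⊢ (A ∧ B)
∧-intro a b = mp a (syll ax-∧-dup (∧-monoʳ (⇒-const b)))

∨-monoˡ : ⊢ (A ⇒ B) → ⊢ (A ∨ C ⇒ B ∨ C)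
∨-monoˡ p = syll ax-∨-comm (syll (expansion p) ax-∨-comm)

∨-mono : ⊢ (A ⇒ A′) → ⊢ (B ⇒ B′) → ⊢ (A ∨ B ⇒ A′ ∨ B′)
∨-mono p q = syll (∨-monoˡ p) (expansion q)

⇒-mono : ⊢ (A′ ⇒ A) → ⊢ (B ⇒ B′) → ⊢ ((A ⇒ B) ⇒ (A′ ⇒ B′))
⇒-mono p q = exportation (syll (∧-monoʳ p) (syll (importation ⇒-refl) q))

neg-antimono : ⊢ (A′ ⇒ A) → ⊢ (neg A ⇒ neg A′)
neg-antimono p = syll ax-neg₁ (syll (⇒-mono p ⇒-refl) ax-neg₂)

·-mono : ⊢ (A ⇒ A′) → ⊢ (B ⇒ B′) → ⊢ (A · B ⇒ A′ · B′)
·-mono p q = syll (framingˡ p) (framingʳ q)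

Subf-self : (χ : Pattern Sig) → Subf x x χ ≡ χ
Subf-self {x = x} (var z) with z ≟ x
... | yes refl = refl
... | no _     = refl
Subf-self (con s)   = refl
Subf-self bot       = refl
Subf-self (neg χ)   = cong neg (Subf-self χ)
Subf-self (χ ⇒ ψ)   = cong₂ _⇒_ (Subf-self χ) (Subf-self ψ)
Subf-self (χ ∧ ψ)   = cong₂ _∧_ (Subf-self χ) (Subf-self ψ)
Subf-self (χ ∨ ψ)   = cong₂ _∨_ (Subf-self χ) (Subf-self ψ)
Subf-self (χ · ψ)   = cong₂ _·_ (Subf-self χ) (Subf-self ψ)
Subf-self {x = x} (all z χ) with z ≟ x
... | yes _ = refl
... | no _  = cong (all z) (Subf-self χ)
Subf-self {x = x} (ex z χ) with z ≟ x
... | yes _ = refl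
... | no _  = cong (ex z) (Subf-self χ)

freeFor-self : (χ : Pattern Sig) → FreeFor x x χ
freeFor-self (var z)   = tt
freeFor-self (con s)   = tt
freeFor-self bot       = tt
freeFor-self (neg χ)   = freeFor-self χ
freeFor-self (χ ⇒ ψ)   = freeFor-self χ , freeFor-self ψ
freeFor-self (χ ∧ ψ)   = freeFor-self χ , freeFor-self ψ
freeFor-self (χ ∨ ψ)   = freeFor-self χ , freeFor-self ψ
freeFor-self (χ · ψ)   = freeFor-self χ , freeFor-self ψ
freeFor-self (all z χ) = (λ _ → tt) , λ z≢x → ⊥-elim ∘ z≢x , freeFor-self χ
freeFor-self (ex z χ)  = (λ _ → tt) , λ z≢x → ⊥-elim ∘ z≢x , freeFor-self χ

Subf-¬free : (χ : Pattern Sig) → ¬ Free x χ → Subf x y χ ≡ χ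
Subf-¬free {x = x} (var z) x∉χ with z ≟ x
... | yes z≡x = ⊥-elim (x∉χ (sym z≡x))
... | no _    = refl
Subf-¬free (con s) _     = refl
Subf-¬free bot _         = refl
Subf-¬free (neg χ) x∉χ   = cong neg (Subf-¬free χ x∉χ)
Subf-¬free (χ ⇒ ψ) x∉χψ  = cong₂ _⇒_ (Subf-¬free χ (x∉χψ ∘ inj₁)) (Subf-¬free ψ (x∉χψ ∘ inj₂))
Subf-¬free (χ ∧ ψ) x∉χψ  = cong₂ _∧_ (Subf-¬free χ (x∉χψ ∘ inj₁)) (Subf-¬free ψ (x∉χψ ∘ inj₂))
Subf-¬free (χ ∨ ψ) x∉χψ  = cong₂ _∨_ (Subf-¬free χ (x∉χψ ∘ inj₁)) (Subf-¬free ψ (x∉χψ ∘ inj₂))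
Subf-¬free (χ · ψ) x∉χψ  = cong₂ _·_ (Subf-¬free χ (x∉χψ ∘ inj₁)) (Subf-¬free ψ (x∉χψ ∘ inj₂))
Subf-¬free {x = x} (all z χ) x∉χ with z ≟ x
... | yes _   = refl
... | no z≢x  = cong (all z) (Subf-¬free χ (λ f → x∉χ (≢-sym z≢x , f)))
Subf-¬free {x = x} (ex z χ) x∉χ with z ≟ x
... | yes _   = refl
... | no z≢x  = cong (ex z) (Subf-¬free χ (λ f → x∉χ (≢-sym z≢x , f)))

¬free⇒freeFor : (χ : Pattern Sig) → ¬ Free x χ → FreeFor x y χ
¬free⇒freeFor (var z) _       = tt
¬free⇒freeFor (con s) _       = tt
¬free⇒freeFor bot _           = tt
¬free⇒freeFor (neg χ) x∉χ     = ¬free⇒freeFor χ x∉χ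
¬free⇒freeFor (χ ⇒ ψ) x∉χψ    = ¬free⇒freeFor χ (x∉χψ ∘ inj₁) , ¬free⇒freeFor ψ (x∉χψ ∘ inj₂)
¬free⇒freeFor (χ ∧ ψ) x∉χψ    = ¬free⇒freeFor χ (x∉χψ ∘ inj₁) , ¬free⇒freeFor ψ (x∉χψ ∘ inj₂)
¬free⇒freeFor (χ ∨ ψ) x∉χψ    = ¬free⇒freeFor χ (x∉χψ ∘ inj₁) , ¬free⇒freeFor ψ (x∉χψ ∘ inj₂)
¬free⇒freeFor (χ · ψ) x∉χψ    = ¬free⇒freeFor χ (x∉χψ ∘ inj₁) , ¬free⇒freeFor ψ (x∉χψ ∘ inj₂)
¬free⇒freeFor (all z χ) x∉χ   =
  (λ _ → tt) , λ z≢x → let x∉body = λ f → x∉χ (≢-sym z≢x , f) in (λ _ → x∉body) , ¬free⇒freeFor χ x∉body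
¬free⇒freeFor (ex z χ) x∉χ    =
  (λ _ → tt) , λ z≢x → let x∉body = λ f → x∉χ (≢-sym z≢x , f) in (λ _ → x∉body) , ¬free⇒freeFor χ x∉body

¬free-Subf : (χ : Pattern Sig) → x ≢ y → ¬ Free x (Subf x y χ)
¬free-Subf {x = x} (var z) x≢y f with z ≟ x
... | yes _   = x≢y f
... | no z≢x  = z≢x (sym f)
¬free-Subf (neg χ) x≢y f          = ¬free-Subf χ x≢y f
¬free-Subf (χ ⇒ ψ) x≢y (inj₁ f)   = ¬free-Subf χ x≢y f
¬free-Subf (χ ⇒ ψ) x≢y (inj₂ f)   = ¬free-Subf ψ x≢y f
¬free-Subf (χ ∧ ψ) x≢y (inj₁ f)   = ¬free-Subf χ x≢y f
¬free-Subf (χ ∧ ψ) x≢y (inj₂ f)   = ¬free-Subf ψ x≢y f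
¬free-Subf (χ ∨ ψ) x≢y (inj₁ f)   = ¬free-Subf χ x≢y f
¬free-Subf (χ ∨ ψ) x≢y (inj₂ f)   = ¬free-Subf ψ x≢y f
¬free-Subf (χ · ψ) x≢y (inj₁ f)   = ¬free-Subf χ x≢y f
¬free-Subf (χ · ψ) x≢y (inj₂ f)   = ¬free-Subf ψ x≢y f
¬free-Subf {x = x} (all z χ) x≢y f with z ≟ x | f
... | yes z≡x | x≢z , _ = x≢z (sym z≡x)
... | no _    | _ , f′  = ¬free-Subf χ x≢y f′
¬free-Subf {x = x} (ex z χ) x≢y f with z ≟ x | f
... | yes z≡x | x≢z , _ = x≢z (sym z≡x)
... | no _    | _ , f′  = ¬free-Subf χ x≢y f′

Subf-inverse : (χ : Pattern Sig) → ¬ Free y χ → FreeFor x y χ → Subf y x (Subf x y χ) ≡ χ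
Subf-inverse {y = y} {x = x} (var z) y∉χ _ with z ≟ x
... | no _     = Subf-¬free (var z) y∉χ
... | yes refl with y ≟ y
...   | yes _   = refl
...   | no y≢y  = ⊥-elim (y≢y refl)
Subf-inverse (con s) _ _                = refl
Subf-inverse bot _ _                    = refl
Subf-inverse (neg χ) y∉χ ff             = cong neg (Subf-inverse χ y∉χ ff)
Subf-inverse (χ ⇒ ψ) y∉χψ (ffχ , ffψ)   =
  cong₂ _⇒_ (Subf-inverse χ (y∉χψ ∘ inj₁) ffχ) (Subf-inverse ψ (y∉χψ ∘ inj₂) ffψ)
Subf-inverse (χ ∧ ψ) y∉χψ (ffχ , ffψ)   =
  cong₂ _∧_ (Subf-inverse χ (y∉χψ ∘ inj₁) ffχ) (Subf-inverse ψ (y∉χψ ∘ inj₂) ffψ)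
Subf-inverse (χ ∨ ψ) y∉χψ (ffχ , ffψ)   =
  cong₂ _∨_ (Subf-inverse χ (y∉χψ ∘ inj₁) ffχ) (Subf-inverse ψ (y∉χψ ∘ inj₂) ffψ)
Subf-inverse (χ · ψ) y∉χψ (ffχ , ffψ)   =
  cong₂ _·_ (Subf-inverse χ (y∉χψ ∘ inj₁) ffχ) (Subf-inverse ψ (y∉χψ ∘ inj₂) ffψ)
Subf-inverse {y = y} {x = x} (all z χ) y∉χ (_ , ff) with z ≟ x
... | yes _ = Subf-¬free (all z χ) y∉χ
... | no z≢x with z ≟ y
...   | yes refl = cong (all z) (Subf-¬free χ (proj₁ (ff z≢x) refl))
...   | no z≢y  = cong (all z) (Subf-inverse χ (λ f → y∉χ (≢-sym z≢y , f)) (proj₂ (ff z≢x)))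
Subf-inverse {y = y} {x = x} (ex z χ) y∉χ (_ , ff) with z ≟ x
... | yes _ = Subf-¬free (ex z χ) y∉χ
... | no z≢x with z ≟ y
...   | yes refl = cong (ex z) (Subf-¬free χ (proj₁ (ff z≢x) refl))
...   | no z≢y  = cong (ex z) (Subf-inverse χ (λ f → y∉χ (≢-sym z≢y , f)) (proj₂ (ff z≢x)))

freeFor-Subf-inverse : (χ : Pattern Sig) → ¬ Free y χ → FreeFor y x (Subf x y χ)
freeFor-Subf-inverse {x = x} (var z) _ with z ≟ x
... | yes _ = tt
... | no _  = tt
freeFor-Subf-inverse (con s) _         = tt
freeFor-Subf-inverse bot _             = tt
freeFor-Subf-inverse (neg χ) y∉χ       = freeFor-Subf-inverse χ y∉χ
freeFor-Subf-inverse (χ ⇒ ψ) y∉χψ      =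
  freeFor-Subf-inverse χ (y∉χψ ∘ inj₁) , freeFor-Subf-inverse ψ (y∉χψ ∘ inj₂)
freeFor-Subf-inverse (χ ∧ ψ) y∉χψ      =
  freeFor-Subf-inverse χ (y∉χψ ∘ inj₁) , freeFor-Subf-inverse ψ (y∉χψ ∘ inj₂)
freeFor-Subf-inverse (χ ∨ ψ) y∉χψ      =
  freeFor-Subf-inverse χ (y∉χψ ∘ inj₁) , freeFor-Subf-inverse ψ (y∉χψ ∘ inj₂)
freeFor-Subf-inverse (χ · ψ) y∉χψ      =
  freeFor-Subf-inverse χ (y∉χψ ∘ inj₁) , freeFor-Subf-inverse ψ (y∉χψ ∘ inj₂)
freeFor-Subf-inverse {x = x} (all z χ) y∉χ with z ≟ x
... | yes _   = ¬free⇒freeFor (all z χ) y∉χ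
... | no z≢x  = (λ _ → tt) , λ z≢y →
  ⊥-elim ∘ z≢x , freeFor-Subf-inverse χ (λ f → y∉χ (≢-sym z≢y , f))
freeFor-Subf-inverse {x = x} (ex z χ) y∉χ with z ≟ x
... | yes _   = ¬free⇒freeFor (ex z χ) y∉χ
... | no z≢x  = (λ _ → tt) , λ z≢y →
  ⊥-elim ∘ z≢x , freeFor-Subf-inverse χ (λ f → y∉χ (≢-sym z≢y , f))

¬free-Subb : (η : Pattern Sig) → ¬ Occurs y η → ¬ Free y (Subb x y η)
¬free-Subb (var z) y∉η            = y∉η
¬free-Subb (neg η) y∉η            = ¬free-Subb η y∉η
¬free-Subb (η ⇒ θ) y∉ηθ (inj₁ f)  = ¬free-Subb η (y∉ηθ ∘ inj₁) f
¬free-Subb (η ⇒ θ) y∉ηθ (inj₂ f)  = ¬free-Subb θ (y∉ηθ ∘ inj₂) f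
¬free-Subb (η ∧ θ) y∉ηθ (inj₁ f)  = ¬free-Subb η (y∉ηθ ∘ inj₁) f
¬free-Subb (η ∧ θ) y∉ηθ (inj₂ f)  = ¬free-Subb θ (y∉ηθ ∘ inj₂) f
¬free-Subb (η ∨ θ) y∉ηθ (inj₁ f)  = ¬free-Subb η (y∉ηθ ∘ inj₁) f
¬free-Subb (η ∨ θ) y∉ηθ (inj₂ f)  = ¬free-Subb θ (y∉ηθ ∘ inj₂) f
¬free-Subb (η · θ) y∉ηθ (inj₁ f)  = ¬free-Subb η (y∉ηθ ∘ inj₁) f
¬free-Subb (η · θ) y∉ηθ (inj₂ f)  = ¬free-Subb θ (y∉ηθ ∘ inj₂) f
¬free-Subb {x = x} (all z η) y∉η f with z ≟ x | f
... | yes _ | y≢y , _ = y≢y refl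
... | no _  | _ , f′  = ¬free-Subb η (y∉η ∘ inj₂) f′
¬free-Subb {x = x} (ex z η) y∉η f with z ≟ x | f
... | yes _ | y≢y , _ = y≢y refl
... | no _  | _ , f′  = ¬free-Subb η (y∉η ∘ inj₂) f′

freeFor-Subb : (η : Pattern Sig) → ¬ Occurs y η → FreeFor x y (Subb x y η)
freeFor-Subb (var z) _           = tt
freeFor-Subb (con s) _           = tt
freeFor-Subb bot _               = tt
freeFor-Subb (neg η) y∉η         = freeFor-Subb η y∉η
freeFor-Subb (η ⇒ θ) y∉ηθ        = freeFor-Subb η (y∉ηθ ∘ inj₁) , freeFor-Subb θ (y∉ηθ ∘ inj₂)
freeFor-Subb (η ∧ θ) y∉ηθ        = freeFor-Subb η (y∉ηθ ∘ inj₁) , freeFor-Subb θ (y∉ηθ ∘ inj₂)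
freeFor-Subb (η ∨ θ) y∉ηθ        = freeFor-Subb η (y∉ηθ ∘ inj₁) , freeFor-Subb θ (y∉ηθ ∘ inj₂)
freeFor-Subb (η · θ) y∉ηθ        = freeFor-Subb η (y∉ηθ ∘ inj₁) , freeFor-Subb θ (y∉ηθ ∘ inj₂)
freeFor-Subb {y = y} {x = x} (all z η) y∉η with z ≟ x
... | yes _ = ¬free⇒freeFor (all y (Subf x y (Subb x y η))) (uncurry (¬free-Subf (Subb x y η)))
... | no _  = (λ _ → tt) , λ _ → (λ z≡y → ⊥-elim (y∉η (inj₁ (sym z≡y)))) , freeFor-Subb η (y∉η ∘ inj₂)
freeFor-Subb {y = y} {x = x} (ex z η) y∉η with z ≟ x
... | yes _ = ¬free⇒freeFor (ex y (Subf x y (Subb x y η))) (uncurry (¬free-Subf (Subb x y η)))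
... | no _  = (λ _ → tt) , λ _ → (λ z≡y → ⊥-elim (y∉η (inj₁ (sym z≡y)))) , freeFor-Subb η (y∉η ∘ inj₂)

∀-elim′ : {χ : Pattern Sig} → FreeFor x y χ → Subf x y χ ≡ A → ⊢ (all x χ ⇒ A)
∀-elim′ ff refl = ax-∀-elim ff

∃-intro′ : {χ : Pattern Sig} → FreeFor x y χ → Subf x y χ ≡ A → ⊢ (A ⇒ ex x χ)
∃-intro′ ff refl = ax-∃-intro ff

all-mono : ⊢ (A ⇒ B) → ⊢ (all x A ⇒ all x B)
all-mono {A = A} p = ∀-gen (λ (x≢x , _) → x≢x refl) (syll (∀-elim′ (freeFor-self A) (Subf-self A)) p)

ex-mono : ⊢ (A ⇒ B) → ⊢ (ex x A ⇒ ex x B)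
ex-mono {B = B} p = ∃-gen (λ (x≢x , _) → x≢x refl) (syll p (∃-intro′ (freeFor-self B) (Subf-self B)))

infix 3 _⊣⊢_
_⊣⊢_ : Pattern Sig → Pattern Sig → Set
A ⊣⊢ B = ⊢ (A ⇒ B) × ⊢ (B ⇒ A)

⊣⊢-refl : A ⊣⊢ A
⊣⊢-refl = ⇒-refl , ⇒-refl

⊣⊢-trans : A ⊣⊢ B → B ⊣⊢ C → A ⊣⊢ C
⊣⊢-trans (p , p′) (q , q′) = syll p q , syll q′ p′

neg-cong : A ⊣⊢ A′ → neg A ⊣⊢ neg A′
neg-cong (p , p′) = neg-antimono p′ , neg-antimono p

⇒-cong : A ⊣⊢ A′ → B ⊣⊢ B′ → (A ⇒ B) ⊣⊢ (A′ ⇒ B′)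
⇒-cong (p , p′) (q , q′) = ⇒-mono p′ q , ⇒-mono p q′

∧-cong : A ⊣⊢ A′ → B ⊣⊢ B′ → A ∧ B ⊣⊢ A′ ∧ B′
∧-cong (p , p′) (q , q′) = ∧-mono p q , ∧-mono p′ q′

∨-cong : A ⊣⊢ A′ → B ⊣⊢ B′ → A ∨ B ⊣⊢ A′ ∨ B′
∨-cong (p , p′) (q , q′) = ∨-mono p q , ∨-mono p′ q′

·-cong : A ⊣⊢ A′ → B ⊣⊢ B′ → A · B ⊣⊢ A′ · B′
·-cong (p , p′) (q , q′) = ·-mono p q , ·-mono p′ q′

all-cong : A ⊣⊢ B → all x A ⊣⊢ all x B
all-cong (p , p′) = all-mono p , all-mono p′

ex-cong : A ⊣⊢ B → ex x A ⊣⊢ ex x B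
ex-cong (p , p′) = ex-mono p , ex-mono p′

all-rename : (η : Pattern Sig) → ¬ Free y η → FreeFor x y η → all x η ⊣⊢ all y (Subf x y η)
all-rename η y∉η ff =
  ∀-gen (y∉η ∘ proj₂) (ax-∀-elim ff) ,
  ∀-gen (uncurry (¬free-Subf η)) (∀-elim′ (freeFor-Subf-inverse η y∉η) (Subf-inverse η y∉η ff))

ex-rename : (η : Pattern Sig) → ¬ Free y η → FreeFor x y η → ex x η ⊣⊢ ex y (Subf x y η)
ex-rename η y∉η ff =
  ∃-gen (uncurry (¬free-Subf η)) (∃-intro′ (freeFor-Subf-inverse η y∉η) (Subf-inverse η y∉η ff)) ,
  ∃-gen (y∉η ∘ proj₂) (ax-∃-intro ff)

Subb-⊣⊢ : (φ : Pattern Sig) → ¬ Occurs y φ → φ ⊣⊢ Subb x y φ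
Subb-⊣⊢ (var z) _       = ⊣⊢-refl
Subb-⊣⊢ (con s) _       = ⊣⊢-refl
Subb-⊣⊢ bot _           = ⊣⊢-refl
Subb-⊣⊢ (neg φ) y∉φ     = neg-cong (Subb-⊣⊢ φ y∉φ)
Subb-⊣⊢ (φ ⇒ ψ) y∉φψ    = ⇒-cong (Subb-⊣⊢ φ (y∉φψ ∘ inj₁)) (Subb-⊣⊢ ψ (y∉φψ ∘ inj₂))
Subb-⊣⊢ (φ ∧ ψ) y∉φψ    = ∧-cong (Subb-⊣⊢ φ (y∉φψ ∘ inj₁)) (Subb-⊣⊢ ψ (y∉φψ ∘ inj₂))
Subb-⊣⊢ (φ ∨ ψ) y∉φψ    = ∨-cong (Subb-⊣⊢ φ (y∉φψ ∘ inj₁)) (Subb-⊣⊢ ψ (y∉φψ ∘ inj₂))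
Subb-⊣⊢ (φ · ψ) y∉φψ    = ·-cong (Subb-⊣⊢ φ (y∉φψ ∘ inj₁)) (Subb-⊣⊢ ψ (y∉φψ ∘ inj₂))
Subb-⊣⊢ {y = y} {x = x} (all z η) y∉η with z ≟ x
... | yes refl = ⊣⊢-trans (all-cong (Subb-⊣⊢ η (y∉η ∘ inj₂)))
                          (all-rename (Subb x y η) (¬free-Subb η (y∉η ∘ inj₂)) (freeFor-Subb η (y∉η ∘ inj₂)))
... | no _     = all-cong (Subb-⊣⊢ η (y∉η ∘ inj₂))
Subb-⊣⊢ {y = y} {x = x} (ex z η) y∉η with z ≟ x
... | yes refl = ⊣⊢-trans (ex-cong (Subb-⊣⊢ η (y∉η ∘ inj₂)))
                          (ex-rename (Subb x y η) (¬free-Subb η (y∉η ∘ inj₂)) (freeFor-Subb η (y∉η ∘ inj₂)))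
... | no _     = ex-cong (Subb-⊣⊢ η (y∉η ∘ inj₂))

mainTheorem14 : {Sig : Set} (φ : Pattern Sig) (x y : EVar) →
                ¬ Occurs y φ → ⊢ (φ ⇔ Subb x y φ)
mainTheorem14 φ x y y∉φ = uncurry ∧-intro (Subb-⊣⊢ φ y∉φ)
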